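{- Let $T_j = \langle S_j, i_j, \mathsf{Act}, \square_j, \to_j\rangle$, for $j\in\{1,2\}$, be two transition systems with responses over the same action set $\mathsf{Act}$. If there exists a refinement $\mathcal{R}\subseteq S_1\times S_2$ from $T_1$ to $T_2$, then $L(T_2)\subseteq L(T_1)$.
   Context: A \emph{transition system with responses} (TSR) is a tuple $T = \langle S, s_0, \mathsf{Act}, \square, \to\rangle$ where: - $S$ is a set of states; - $s_0\in S$ is the initial state; - $\mathsf{Act}$ is a set of actions; - $\to\subseteq S\times\mathsf{Act}\times S$ is an action-deterministic transition relation, meaning that for each $s$ and $a$ there is at most one $s'$ with $(s,a,s')\in\to$; we write $s\xrightarrow{a}s'$ for $(s,a,s')\in\to$; - $\square: S\to\mathcal{P}(\mathsf{Act})$ assigns to each state its set of response actions. A \emph{run} of $T$ is a finite sequence of transitions $s_0\xrightarrow{a_0}s_1\xrightarrow{a_1}\cdots\xrightarrow{a_{n-1}}s_n$ starting at the initial state $s_0$ ($n\ge 0$). The run is \emph{accepting} if $\square(s_n)=\emptyset$. The \emph{language} $L(T)$ is the set of all action sequences $a_0a_1\cdots a_{n-1}$ labelling accepting runs. A binary relation $\mathcal{R}\subseteq S_1\times S_2$ is a \emph{refinement} (from $T_1$ to $T_2$) if: 1. $i_1\,\mathcal{R}\,i_2$; and 2. whenever $s_1\,\mathcal{R}\,s_2$: (a) $\square_1(s_1)\subseteq\square_2(s_2)$; (b) for every transition $s_1\xrightarrow{a}_1 s_1'$ with $a\in\square_1(s_1)$ there is a transition $s_2\xrightarrow{a}_2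 s_2'$ with $s_1'\,\mathcal{R}\,s_2'$; (c) for every transition $s_2\xrightarrow{a}_2 s_2'$ there is a transition $s_1\xrightarrow{a}_1 s_1'$ with $s_1'\,\mathcal{R}\,s_2'$. -}

module Defs where

open import Level using (Level; _⊔_; suc)
open import Data.List using (List; []; _∷_)
open import Data.Product using (Σ; _×_; _,_; ∃)
open import Relation.Nullary using (¬_)
open import Relation.Binary.PropositionalEquality using (_≡_)

record TSR {a : Level} (Act : Set a) (ℓ : Level) : Set (a ⊔ suc ℓ) where
  field
    S     : Set ℓ
    s₀    : S
    _─[_]→_ : S → Act → S → Set ℓ
    deterministic : ∀ {s x s' s''} → s ─[ x ]→ s' → s ─[ x ]→ s'' → s' ≡ s''
    □     : S → Act → Set ℓ   -- □ s x  means  x ∈ □(s)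

module _ {a ℓ : Level} {Act : Set a} (T : TSR Act ℓ) where
  open TSR T

  data Path : S → List Act → S → Set (a ⊔ ℓ) where
    done : ∀ {s} → Path s [] s
    step : ∀ {s x s' w t} → s ─[ x ]→ s' → Path s' w t → Path s (x ∷ w) t

  Run : List Act → S → Set (a ⊔ ℓ)
  Run w t = Path s₀ w t

  Accepting : S → Set (a ⊔ ℓ)
  Accepting t = ∀ x → ¬ □ t x

  _∈L : List Act → Set (a ⊔ ℓ)
  w ∈L = Σ S λ t → Run w t × Accepting t

module _ {a ℓ₁ ℓ₂ : Level} {Act : Set a} (T₁ : TSR Act ℓ₁) (T₂ : TSR Act ℓ₂) where
  private
    module T₁ = TSR T₁
    module T₂ = TSR T₂

  record IsRefinement {r : Level} (R : T₁.S → T₂.S → Set r) : Set (a ⊔ ℓ₁ ⊔ ℓ₂ ⊔ r) where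
    field
      init : R T₁.s₀ T₂.s₀
      resp⊆ : ∀ {s₁ s₂} → R s₁ s₂ → ∀ x → T₁.□ s₁ x → T₂.□ s₂ x
      fwd : ∀ {s₁ s₂} → R s₁ s₂ → ∀ {x s₁'} → T₁._─[_]→_ s₁ x s₁' → T₁.□ s₁ x →
            Σ T₂.S λ s₂' → T₂._─[_]→_ s₂ x s₂' × R s₁' s₂'
      bwd : ∀ {s₁ s₂} → R s₁ s₂ → ∀ {x s₂'} → T₂._─[_]→_ s₂ x s₂' →
            Σ T₁.S λ s₁' → T₁._─[_]→_ s₁ x s₁' × R s₁' s₂'

  LangIncl : Set (a ⊔ ℓ₁ ⊔ ℓ₂)
  LangIncl = ∀ w → _∈L T₂ w → _∈L T₁ w

-- Only two of the refinement clauses are needed.  Clause (c), the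
-- backward simulation condition, lets every T₂-path starting in an
-- R-related state be matched, transition by transition, by a T₁-path
-- with the same label whose end state is again R-related to the end of
-- the T₂-path (`liftPath`, by induction on the path).  Clause (a),
-- □₁ ⊆ □₂ on related states, shows that a state related to an accepting
-- T₂-state is itself accepting (`acceptance-reflected`).  The theorem
-- follows by lifting an accepting T₂-run from the related initial
-- states and reflecting acceptance at its end.
module Submission where

open import Defs
open import Level using (Level)
open import Data.Product using (Σ; _,_; _×_)
open import Data.List using (List)

module _ {a ℓ₁ ℓ₂ r : Level} {Act : Set a} (T₁ : TSR Act ℓ₁) (T₂ : TSR Act ℓ₂)
         (R : TSR.S T₁ → TSR.S T₂ → Set r) where
  private
    module T₁ = TSR T₁
    module T₂ = TSR T₂

  BackwardSimulation : Set _
  BackwardSimulation = ∀ {s₁ s₂} → R s₁ s₂ → ∀ {x s₂'} → T₂._─[_]→_ s₂ x s₂' →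
                       Σ T₁.S λ s₁' → T₁._─[_]→_ s₁ x s₁' × R s₁' s₂'

  liftPath : BackwardSimulation → ∀ {s₁ s₂ w t₂} → R s₁ s₂ → Path T₂ s₂ w t₂ →
             Σ T₁.S λ t₁ → Path T₁ s₁ w t₁ × R t₁ t₂
  liftPath sim {s₁} related done = s₁ , done , related
  liftPath sim related (step tr₂ path₂) with sim related tr₂
  ... | s₁' , tr₁ , related' with liftPath sim related' path₂
  ...   | t₁ , path₁ , relatedEnd = t₁ , step tr₁ path₁ , relatedEnd

  acceptance-reflected : (∀ {s₁ s₂} → R s₁ s₂ → ∀ x → T₁.□ s₁ x → T₂.□ s₂ x) →
                         ∀ {s₁ s₂} → R s₁ s₂ → Accepting T₂ s₂ → Accepting T₁ s₁
  acceptance-reflected resp⊆ related accepting₂ x response₁ =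
    accepting₂ x (resp⊆ related x response₁)

mainTheorem2 : {a ℓ₁ ℓ₂ r : Level} {Act : Set a} (T₁ : TSR Act ℓ₁) (T₂ : TSR Act ℓ₂) →
    Σ (TSR.S T₁ → TSR.S T₂ → Set r) (IsRefinement T₁ T₂) →
    LangIncl T₁ T₂
mainTheorem2 T₁ T₂ (R , refinement) w (t₂ , run₂ , accepting₂) =
  conclude (liftPath T₁ T₂ R bwd init run₂)
  where
    open IsRefinement refinement

    conclude : Σ (TSR.S T₁) (λ t₁ → Path T₁ (TSR.s₀ T₁) w t₁ × R t₁ t₂) → _∈L T₁ w
    conclude (t₁ , run₁ , related) =
      t₁ , run₁ , acceptance-reflected T₁ T₂ R resp⊆ related accepting₂
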